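{- Let $H$ be a finite simple graph without isolated vertices. Then either $str(H)=|V(H)|+\delta(H)$, or $H$ is a proper subgraph of a graph $G$ such that $str(G)=|V(G)|+\delta(G)$ and $\delta(G)=\delta(H)$.
   Context: For a graph $G$ of order $p$ with at least one edge, a numbering is a bijection $f:V(G)\to\{1,\dots,p\}$; $str_f(G)=\max\{f(u)+f(v): uv\in E(G)\}$ and $str(G)=\min\{str_f(G): f \text{ a numbering of } G\}$. $\delta(\cdot)$ denotes minimum degree. -}

module Defs where

open import Data.Nat using (ℕ; zero; suc; _+_; _≤_; _<_; _⊔_; _⊓_)
open import Data.Fin using (Fin; toℕ)
open import Data.Bool using (Bool; true; false; if_then_else_)
open import Data.List using (List; foldr; map; concatMap; filter; length)
open import Data.List using () renaming (allFin to allFinL)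
open import Data.Product using (Σ; ∃; ∃-syntax; _×_; _,_)
open import Data.Sum using (_⊎_)
open import Relation.Binary.PropositionalEquality using (_≡_)
open import Relation.Nullary using (¬_)
open import Function.Bundles using (_↔_; Injection; Inverse)
open import Function.Definitions using (Injective)

record Graph (n : ℕ) : Set where
  field
    adj   : Fin n → Fin n → Bool
    sym   : ∀ u v → adj u v ≡ adj v u
    irref : ∀ u → adj u u ≡ false
open Graph public

order : ∀ {n} → Graph n → ℕ
order {n} _ = n

Adj : ∀ {n} → Graph n → Fin n → Fin n → Set
Adj G u v = adj G u v ≡ true

deg : ∀ {n} → Graph n → Fin n → ℕ
deg {n} G u = length (filter (λ v → adj G u v Data.Bool.≟ true) (allFinL n))
  where import Data.Bool

-- minimum degree δ(G); the initial value n exceeds every degree, so for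
-- n ≥ 1 this is exactly the minimum of the degrees.
δ : ∀ {n} → Graph n → ℕ
δ {n} G = foldr (λ u m → deg G u ⊓ m) n (allFinL n)

NoIsolated : ∀ {n} → Graph n → Set
NoIsolated {n} G = ∀ (u : Fin n) → ∃[ v ] Adj G u v

-- A numbering is a bijection V(G) → {1,…,p}; we represent it as a
-- bijection f : Fin n ↔ Fin n, with the label of u being toℕ (f u) + 1.
Numbering : ℕ → Set
Numbering n = Fin n ↔ Fin n

label : ∀ {n} → Numbering n → Fin n → ℕ
label f u = suc (toℕ (Inverse.to f u))

-- str_f(G) = max { f(u) + f(v) : uv ∈ E(G) }  (0 if G has no edges)
strf : ∀ {n} → Graph n → Numbering n → ℕ
strf {n} G f =
  foldr _⊔_ 0
    (concatMap (λ u → map (λ v → if adj G u v then label f u + label f v else 0)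
                          (allFinL n))
               (allFinL n))

IsStr : ∀ {n} → Graph n → ℕ → Set
IsStr {n} G s = (∃[ f ] strf G f ≡ s) × (∀ (f : Numbering n) → s ≤ strf G f)

ProperSubgraph : ∀ {n m} → Graph n → Graph m → Set
ProperSubgraph {n} {m} H G =
  Σ (Fin n → Fin m) λ ι →
    Injective _≡_ _≡_ ι ×
    (∀ u v → Adj H u v → Adj G (ι u) (ι v)) ×
    ((n < m) ⊎ (∃[ u ] ∃[ v ] (Adj G (ι u) (ι v) × ¬ Adj H u v)))

-- Any graph G with δ(G) ≥ 1 has str_f(G) ≥ |V(G)| + δ(G) for every numbering f: the vertex
-- labelled p has at least δ neighbours, which carry distinct labels, so one of them is labelled
-- at least δ. Hence it suffices to embed H into a larger graph with the same minimum degree in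
-- which some numbering attains this bound. Add n new, pairwise non-adjacent vertices, each joined
-- to the δ(H) vertices of H with the smallest indices. Numbering vertices by index, the old
-- vertices get 1..n and the new ones n+1..2n, so an edge of H has label sum at most 2n and an edge
-- at a new vertex at most 2n + δ; every degree stays at least δ(H) and the new vertices have degree
-- exactly δ(H).

module Submission where

open import Defs
open import Data.Nat using (ℕ; _+_)
open import Data.Product using (Σ; ∃; ∃-syntax; _×_)
open import Data.Sum using (_⊎_)
open import Relation.Binary.PropositionalEquality using (_≡_)

open import Data.Bool using (Bool; true; false; _≟_; if_then_else_)
open import Data.Bool.Properties using (T-≡)
open import Data.Empty using (⊥; ⊥-elim)
open import Data.Fin using (Fin; toℕ; fromℕ; _↑ˡ_; _↑ʳ_; splitAt; inject≤)
open import Data.Fin.Patterns using (0F)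
open import Data.Fin.Properties
  using (any?; toℕ-injective; toℕ<n; toℕ-fromℕ; toℕ-↑ˡ; ↑ˡ-injective;
         splitAt-↑ˡ; splitAt-↑ʳ; splitAt⁻¹-↑ˡ; splitAt⁻¹-↑ʳ; toℕ-inject≤; inject≤-injective)
open import Data.List using (List; []; _∷_; length; filter; foldr; map; concatMap)
open import Data.List using () renaming (allFin to allFinL)
open import Data.List.Properties using (length-upTo; length-tabulate; length-removeAt′)
open import Data.List.Membership.Propositional using (_∈_; _─_)
open import Data.List.Membership.Propositional.Properties using (∈-filter⁺; ∈-filter⁻; ∈-allFin; ∈-upTo⁺; ∈-map⁺; ∈-map⁻; ∈-concatMap⁺; ∈-concatMap⁻)
open import Data.List.Relation.Unary.Any using (here; there)
import Data.List.Relation.Unary.Any as Any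
import Data.List.Relation.Unary.All as All
open import Data.List.Relation.Unary.AllPairs using (_∷_)
open import Data.List.Relation.Unary.Unique.Propositional using (Unique)
open import Data.List.Relation.Unary.Unique.Propositional.Properties using (filter⁺; allFin⁺)
open import Data.Nat using (suc; zero; _≤_; _<_; _⊓_; _⊔_; _<ᵇ_; z≤n; s≤s)
open import Data.Nat.Properties
  using (≤-refl; ≤-reflexive; ≤-trans; ≤-antisym; _≤?_; <⇒≱; ≰⇒>; <ᵇ⇒<; <⇒<ᵇ; +-comm; +-mono-≤; +-monoʳ-≤;
         m≤m+n; m<m+n; m⊓n≤m; m⊓n≤n; ⊓-glb; m≤m⊔n; m≤n⊔m; ⊔-lub)
open import Data.Product using (_,_; proj₁; proj₂)
open import Data.Sum using (inj₁; inj₂)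
open import Function using (_∘_)
open import Function.Bundles using (Inverse; Injection; Equivalence)
open import Function.Construct.Identity using (↔-id)
open import Function.Definitions using (Injective)
open import Function.Properties.Inverse using (Inverse⇒Injection)
open import Relation.Nullary using (yes; no)
open import Relation.Nullary.Decidable using (_×-dec_)
open import Relation.Binary.PropositionalEquality using (refl; trans; cong; subst; _≢_)
import Relation.Binary.PropositionalEquality as ≡

private
  variable
    k m n : ℕ

∈-─ : ∀ {A : Set} {x y : A} {ys : List A} → x ∈ ys → (y∈ys : y ∈ ys) → x ≢ y → x ∈ ys ─ y∈ys
∈-─ (here refl) (here refl) x≢y = ⊥-elim (x≢y refl)
∈-─ (there x∈ys) (here _) _ = x∈ys
∈-─ (here refl) (there _) _ = here refl
∈-─ (there x∈ys) (there y∈ys) x≢y = there (∈-─ x∈ys y∈ys x≢y)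

length-≤-injection : ∀ {A B : Set} {xs : List A} {ys : List B} (g : A → B) →
  Unique xs → Injective _≡_ _≡_ g → (∀ {x} → x ∈ xs → g x ∈ ys) → length xs ≤ length ys
length-≤-injection {xs = []} g _ _ _ = z≤n
length-≤-injection {xs = x ∷ xs} {ys} g (x∉xs ∷ xs!) g-inj xs↦ys =
  subst (suc (length xs) ≤_) (≡.sym (length-removeAt′ ys _))
    (s≤s (length-≤-injection g xs! g-inj λ x′∈xs →
      ∈-─ (xs↦ys (there x′∈xs)) gx∈ys
        λ gx′≡gx → All.lookup x∉xs x′∈xs (≡.sym (g-inj gx′≡gx))))
  where gx∈ys = xs↦ys (here refl)

neighbours : Graph n → Fin n → List (Fin n)
neighbours {n} G u = filter (λ v → adj G u v ≟ true) (allFinL n)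

module _ (G : Graph n) where

  Adj-sym : ∀ {u v} → Adj G u v → Adj G v u
  Adj-sym {u} {v} u~v = trans (Graph.sym G v u) u~v

  neighbours-unique : ∀ u → Unique (neighbours G u)
  neighbours-unique u = filter⁺ (λ v → adj G u v ≟ true) (allFin⁺ n)

  ∈-neighbours⁺ : ∀ {u v} → Adj G u v → v ∈ neighbours G u
  ∈-neighbours⁺ {u} {v} = ∈-filter⁺ (λ v → adj G u v ≟ true) (∈-allFin v)

  ∈-neighbours⁻ : ∀ {u v} → v ∈ neighbours G u → Adj G u v
  ∈-neighbours⁻ {u} = proj₂ ∘ ∈-filter⁻ (λ v → adj G u v ≟ true) {xs = allFinL n}

  deg-≤ : ∀ {u} (g : Fin n → ℕ) → Injective _≡_ _≡_ g →
    (∀ v → Adj G u v → g v < k) → deg G u ≤ k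
  deg-≤ {k} {u} g g-inj below = subst (deg G u ≤_) (length-upTo k)
    (length-≤-injection g (neighbours-unique u) g-inj
      λ {v} v∈nbrs → ∈-upTo⁺ (below v (∈-neighbours⁻ v∈nbrs)))

  deg-≥ : ∀ {u} (h : Fin k → Fin n) → Injective _≡_ _≡_ h →
    (∀ i → Adj G u (h i)) → k ≤ deg G u
  deg-≥ {k} h h-inj adjacent = subst (_≤ _) (length-tabulate {n = k} (λ i → i))
    (length-≤-injection h (allFin⁺ k) h-inj λ {i} _ → ∈-neighbours⁺ (adjacent i))

  neighbour-≥ : ∀ {u} (g : Fin n → ℕ) → Injective _≡_ _≡_ g →
    suc k ≤ deg G u → ∃[ v ] Adj G u v × k ≤ g v
  neighbour-≥ {k} {u} g g-inj k<deg
    with any? (λ v → (adj G u v ≟ true) ×-dec (k ≤? g v))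
  ... | yes found = found
  ... | no none = ⊥-elim (<⇒≱ k<deg (deg-≤ g g-inj λ v u~v → ≰⇒> λ k≤gv → none (v , u~v , k≤gv)))

deg-≤-embedding : (H : Graph n) (G : Graph m) (ι : Fin n → Fin m) → Injective _≡_ _≡_ ι →
  (∀ u v → Adj H u v → Adj G (ι u) (ι v)) → ∀ u → deg H u ≤ deg G (ι u)
deg-≤-embedding H G ι ι-inj preserves u =
  length-≤-injection ι (neighbours-unique H u) ι-inj
    λ {v} v∈nbrs → ∈-neighbours⁺ G (preserves u v (∈-neighbours⁻ H v∈nbrs))

module _ (G : Graph n) where

  private
    minDeg : List (Fin n) → ℕ
    minDeg = foldr (λ u d → deg G u ⊓ d) n

    minDeg-≤-deg : ∀ {u} us → u ∈ us → minDeg us ≤ deg G u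
    minDeg-≤-deg (_ ∷ _) (here refl) = m⊓n≤m _ _
    minDeg-≤-deg (_ ∷ us) (there u∈us) = ≤-trans (m⊓n≤n _ _) (minDeg-≤-deg us u∈us)

    minDeg-greatest : ∀ us → k ≤ n → (∀ u → k ≤ deg G u) → k ≤ minDeg us
    minDeg-greatest [] k≤n _ = k≤n
    minDeg-greatest (u ∷ us) k≤n k≤deg = ⊓-glb (k≤deg u) (minDeg-greatest us k≤n k≤deg)

    minDeg-≤-order : ∀ us → minDeg us ≤ n
    minDeg-≤-order [] = ≤-refl
    minDeg-≤-order (_ ∷ us) = ≤-trans (m⊓n≤n _ _) (minDeg-≤-order us)

  δ≤deg : ∀ u → δ G ≤ deg G u
  δ≤deg u = minDeg-≤-deg (allFinL n) (∈-allFin u)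

  δ-greatest : k ≤ n → (∀ u → k ≤ deg G u) → k ≤ δ G
  δ-greatest = minDeg-greatest (allFinL n)

  δ≤order : δ G ≤ n
  δ≤order = minDeg-≤-order (allFinL n)

  δ-positive : NoIsolated G → Fin n → 1 ≤ δ G
  δ-positive noIsolated u = δ-greatest (≤-trans (s≤s z≤n) (toℕ<n u)) λ v →
    deg-≥ G (λ _ → proj₁ (noIsolated v)) (λ { {0F} {0F} _ → refl }) (λ _ → proj₂ (noIsolated v))

foldr⊔-upperBound : ∀ {x} xs → x ∈ xs → x ≤ foldr _⊔_ 0 xs
foldr⊔-upperBound (_ ∷ _) (here refl) = m≤m⊔n _ _
foldr⊔-upperBound (_ ∷ xs) (there x∈xs) = ≤-trans (foldr⊔-upperBound xs x∈xs) (m≤n⊔m _ _)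

foldr⊔-least : ∀ {b} xs → (∀ {x} → x ∈ xs → x ≤ b) → foldr _⊔_ 0 xs ≤ b
foldr⊔-least [] _ = z≤n
foldr⊔-least (_ ∷ xs) ≤b = ⊔-lub (≤b (here refl)) (foldr⊔-least xs (≤b ∘ there))

module _ (G : Graph n) (f : Numbering n) where

  private
    edgeSum : Fin n → Fin n → ℕ
    edgeSum u v = if adj G u v then label f u + label f v else 0

    edgeSums : List ℕ
    edgeSums = concatMap (λ u → map (edgeSum u) (allFinL n)) (allFinL n)

    ∈-edgeSums : ∀ u v → edgeSum u v ∈ edgeSums
    ∈-edgeSums u v = ∈-concatMap⁺ (λ u → map (edgeSum u) (allFinL n))
      (Any.map (λ { refl → ∈-map⁺ (edgeSum u) (∈-allFin v) }) (∈-allFin u))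

  strf-edge : ∀ {u v} → Adj G u v → label f u + label f v ≤ strf G f
  strf-edge {u} {v} u~v = foldr⊔-upperBound edgeSums
    (subst (_∈ edgeSums) (cong (if_then _ else _) u~v) (∈-edgeSums u v))

  strf-least : ∀ {b} → (∀ u v → Adj G u v → label f u + label f v ≤ b) → strf G f ≤ b
  strf-least {b} bounded = foldr⊔-least edgeSums λ x∈edgeSums →
    let u , x∈row = Any.satisfied (∈-concatMap⁻ (λ u → map (edgeSum u) (allFinL n)) {xs = allFinL n} x∈edgeSums)
        v , _ , x≡edgeSum = ∈-map⁻ (edgeSum u) x∈row
    in subst (_≤ b) (≡.sym x≡edgeSum) (edgeSum-≤ u v)
    where
    edgeSum-≤ : ∀ u v → edgeSum u v ≤ b
    edgeSum-≤ u v with adj G u v in u~v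
    ... | true = bounded u v u~v
    ... | false = z≤n

label+δ≤strf : (G : Graph m) (f : Numbering m) (u : Fin m) → 1 ≤ δ G → label f u + δ G ≤ strf G f
label+δ≤strf G f u _ with δ G | δ≤deg G u
... | suc d | d<deg-u
  with v , u~v , d≤v ← neighbour-≥ G (toℕ ∘ Inverse.to f)
                         (Injection.injective (Inverse⇒Injection f) ∘ toℕ-injective) d<deg-u
  = ≤-trans (+-monoʳ-≤ (label f u) (s≤s d≤v)) (strf-edge G f u~v)

order+δ≤strf : (G : Graph m) (f : Numbering m) → 1 ≤ δ G → m + δ G ≤ strf G f
order+δ≤strf {zero} G f ()
order+δ≤strf {suc k} G f = subst (λ l → l + δ G ≤ strf G f) label-top ∘ label+δ≤strf G f top
  where
  top : Fin (suc k)
  top = Inverse.from f (fromℕ k)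
  label-top : label f top ≡ suc k
  label-top = cong suc (trans (cong toℕ (Inverse.strictlyInverseˡ f (fromℕ k))) (toℕ-fromℕ k))

IsStr-order+δ : (G : Graph m) (f : Numbering m) → 1 ≤ δ G → strf G f ≤ m + δ G → IsStr G (m + δ G)
IsStr-order+δ G f δ≥1 strf≤ =
  (f , ≤-antisym strf≤ (order+δ≤strf G f δ≥1)) , λ g → order+δ≤strf G g δ≥1

module Extension (H : Graph n) where

  private
    d : ℕ
    d = δ H

    adj⊎ : Fin n ⊎ Fin n → Fin n ⊎ Fin n → Bool
    adj⊎ (inj₁ a) (inj₁ b) = adj H a b
    adj⊎ (inj₁ a) (inj₂ _) = toℕ a <ᵇ d
    adj⊎ (inj₂ _) (inj₁ b) = toℕ b <ᵇ d
    adj⊎ (inj₂ _) (inj₂ _) = false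

    adj⊎-sym : ∀ x y → adj⊎ x y ≡ adj⊎ y x
    adj⊎-sym (inj₁ a) (inj₁ b) = Graph.sym H a b
    adj⊎-sym (inj₁ _) (inj₂ _) = refl
    adj⊎-sym (inj₂ _) (inj₁ _) = refl
    adj⊎-sym (inj₂ _) (inj₂ _) = refl

    adj⊎-irrefl : ∀ x → adj⊎ x x ≡ false
    adj⊎-irrefl (inj₁ a) = irref H a
    adj⊎-irrefl (inj₂ _) = refl

  extension : Graph (n + n)
  extension = record
    { adj = λ u v → adj⊎ (splitAt n u) (splitAt n v)
    ; sym = λ u v → adj⊎-sym (splitAt n u) (splitAt n v)
    ; irref = λ u → adj⊎-irrefl (splitAt n u)
    }

  data Side : Fin (n + n) → Set where
    old : ∀ a → Side (a ↑ˡ n)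
    new : ∀ j → Side (n ↑ʳ j)

  side : ∀ w → Side w
  side w with splitAt n w in split≡
  ... | inj₁ a = subst Side (splitAt⁻¹-↑ˡ split≡) (old a)
  ... | inj₂ j = subst Side (splitAt⁻¹-↑ʳ split≡) (new j)

  adj-old-old : ∀ a b → adj extension (a ↑ˡ n) (b ↑ˡ n) ≡ adj H a b
  adj-old-old a b rewrite splitAt-↑ˡ n a n | splitAt-↑ˡ n b n = refl

  adj-new-old : ∀ j b → adj extension (n ↑ʳ j) (b ↑ˡ n) ≡ (toℕ b <ᵇ d)
  adj-new-old j b rewrite splitAt-↑ʳ n n j | splitAt-↑ˡ n b n = refl

  adj-new-new : ∀ i j → adj extension (n ↑ʳ i) (n ↑ʳ j) ≡ false
  adj-new-new i j rewrite splitAt-↑ʳ n n i | splitAt-↑ʳ n n j = refl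

  Adj-new-old⇒< : ∀ {j b} → Adj extension (n ↑ʳ j) (b ↑ˡ n) → toℕ b < d
  Adj-new-old⇒< {j} {b} j~b = <ᵇ⇒< (toℕ b) d (Equivalence.from T-≡ (trans (≡.sym (adj-new-old j b)) j~b))

  <⇒Adj-new-old : ∀ {j b} → toℕ b < d → Adj extension (n ↑ʳ j) (b ↑ˡ n)
  <⇒Adj-new-old {j} {b} b<d = trans (adj-new-old j b) (Equivalence.to T-≡ (<⇒<ᵇ b<d))

  ¬Adj-new-new : ∀ {i j} → Adj extension (n ↑ʳ i) (n ↑ʳ j) → ⊥
  ¬Adj-new-new {i} {j} i~j with () ← trans (≡.sym (adj-new-new i j)) i~j

  old-preserves-Adj : ∀ a b → Adj H a b → Adj extension (a ↑ˡ n) (b ↑ˡ n)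
  old-preserves-Adj a b a~b = trans (adj-old-old a b) a~b

  H⊂extension : Fin n → ProperSubgraph H extension
  H⊂extension a = (_↑ˡ n) , ↑ˡ-injective n _ _ , old-preserves-Adj ,
                  inj₁ (m<m+n n (≤-trans (s≤s z≤n) (toℕ<n a)))

  deg-old : ∀ a → deg H a ≤ deg extension (a ↑ˡ n)
  deg-old = deg-≤-embedding H extension (_↑ˡ n) (↑ˡ-injective n _ _) old-preserves-Adj

  toℕ-old-< : ∀ {a : Fin n} {b} → toℕ a < b → toℕ (a ↑ˡ n) < b
  toℕ-old-< {a} = subst (_< _) (≡.sym (toℕ-↑ˡ a n))

  deg-new : ∀ j → deg extension (n ↑ʳ j) ≡ d
  deg-new j = ≤-antisym (deg-≤ extension toℕ toℕ-injective neighbours-<)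
                        (deg-≥ extension below-δ below-δ-injective λ _ → <⇒Adj-new-old below-δ-<)
    where
    d≤n : d ≤ n
    d≤n = δ≤order H

    below-δ : Fin d → Fin (n + n)
    below-δ i = inject≤ i d≤n ↑ˡ n

    below-δ-injective : Injective _≡_ _≡_ below-δ
    below-δ-injective = inject≤-injective d≤n d≤n _ _ ∘ ↑ˡ-injective n _ _

    below-δ-< : ∀ {i} → toℕ (inject≤ i d≤n) < d
    below-δ-< {i} = subst (_< d) (≡.sym (toℕ-inject≤ i d≤n)) (toℕ<n i)

    neighbours-< : ∀ v → Adj extension (n ↑ʳ j) v → toℕ v < d
    neighbours-< v j~v with side v
    ... | old b = toℕ-old-< (Adj-new-old⇒< j~v)
    ... | new _ = ⊥-elim (¬Adj-new-new j~v)

  δ-extension : Fin n → δ extension ≡ d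
  δ-extension j = ≤-antisym
    (subst (δ extension ≤_) (deg-new j) (δ≤deg extension (n ↑ʳ j)))
    (δ-greatest extension (≤-trans (δ≤order H) (m≤m+n n n)) d≤deg)
    where
    d≤deg : ∀ w → d ≤ deg extension w
    d≤deg w with side w
    ... | old a = ≤-trans (δ≤deg H a) (deg-old a)
    ... | new i = ≤-reflexive (≡.sym (deg-new i))

  strf-identity : strf extension (↔-id _) ≤ n + n + d
  strf-identity = strf-least extension (↔-id _) edge-≤
    where
    edge-≤ : ∀ u v → Adj extension u v → suc (toℕ u) + suc (toℕ v) ≤ n + n + d
    edge-≤ u v u~v with side u | side v
    ... | old a | old b = ≤-trans (+-mono-≤ (toℕ-old-< (toℕ<n a)) (toℕ-old-< (toℕ<n b))) (m≤m+n (n + n) d)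
    ... | old _ | new j = ≤-trans
      (+-mono-≤ (toℕ-old-< (Adj-new-old⇒< (Adj-sym extension u~v))) (toℕ<n (n ↑ʳ j)))
      (≤-reflexive (+-comm d (n + n)))
    ... | new j | old _ = +-mono-≤ (toℕ<n (n ↑ʳ j)) (toℕ-old-< (Adj-new-old⇒< u~v))
    ... | new _ | new _ = ⊥-elim (¬Adj-new-new u~v)

mainTheorem2 : ∀ {n} (H : Graph n) → NoIsolated H →
    (∃[ u ] ∃[ v ] Adj H u v) →
    IsStr H (n + δ H) ⊎
    (∃[ m ] Σ (Graph m) λ G → ProperSubgraph H G × IsStr G (m + δ G) × δ G ≡ δ H)
mainTheorem2 {n} H noIsolated (u , _) =
  inj₂ (n + n , extension , H⊂extension u , str-extension , δ-extension u)
  where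
  open Extension H

  δ≥1 : 1 ≤ δ extension
  δ≥1 = subst (1 ≤_) (≡.sym (δ-extension u)) (δ-positive H noIsolated u)

  str-extension : IsStr extension (n + n + δ extension)
  str-extension = IsStr-order+δ extension (↔-id _) δ≥1
    (subst (λ d → strf extension (↔-id _) ≤ n + n + d) (≡.sym (δ-extension u)) strf-identity)
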